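{- For all integers $p,q,r\geq 3$, the complete bipartite graph $K_{2,r}$ is a contraction of $W_{p,q}$ if and only if $r=p+1$.
   Context: Graphs are finite, simple. For $p,q\in\mathbb{N}$, $W_{p,q}$ is the graph obtained from the disjoint union of the edgeless graph $\overline{K}_p$ and the complete bipartite graph $K_{2,q}$ by adding two new non-adjacent vertices, each adjacent to every vertex of that disjoint union. Contracting an edge $\{u,v\}$ means adding a new vertex adjacent to all neighbours of $u$ and $v$ and deleting $u,v$; $H$ is a contraction of $G$ if obtained by a sequence of edge contractions. -}

module Defs where

open import Data.Nat using (ℕ; zero; suc; _+_; _<ᵇ_)
open import Data.Fin using (Fin; toℕ; punchOut)
open import Data.Fin.Properties using (_≟_)
open import Data.Product using (Σ; _×_; _,_)
open import Data.Bool using (Bool; true; false; if_then_else_; T)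
open import Data.Empty using (⊥)
open import Relation.Nullary using (¬_; yes; no)
open import Relation.Binary.PropositionalEquality using (_≡_; _≢_; refl; sym)
open import Function.Bundles using (_↔_; Inverse)

record Graph (n : ℕ) : Set₁ where
  field
    Adj     : Fin n → Fin n → Set
    symAdj  : ∀ {x y} → Adj x y → Adj y x
    irrefl  : ∀ {x} → ¬ Adj x x
open Graph public

record _≅_ {m n : ℕ} (G : Graph m) (H : Graph n) : Set where
  field
    bij     : Fin m ↔ Fin n
    preserve : ∀ x y → Adj G x y → Adj H (Inverse.to bij x) (Inverse.to bij y)
    reflect  : ∀ x y → Adj H (Inverse.to bij x) (Inverse.to bij y) → Adj G x y

-- Contracting the edge {u,v} of G (on Fin (suc n))
-- yields a graph on Fin n: the map `merge` sends v to (the image of) u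
-- and is the order-preserving renumbering on the remaining vertices.

merge : ∀ {n} (u v : Fin (suc n)) → u ≢ v → Fin (suc n) → Fin n
merge u v u≢v x with v ≟ x
... | yes _   = punchOut {i = v} {j = u} (λ e → u≢v (sym e))
... | no v≢x  = punchOut {i = v} {j = x} v≢x

contract : ∀ {n} (G : Graph (suc n)) (u v : Fin (suc n)) → Adj G u v → Graph n
contract {n} G u v e = record
  { Adj    = CAdj
  ; symAdj = λ { (a≢b , x , y , p , q , g) → (λ eq → a≢b (sym eq)) , y , x , q , p , symAdj G g }
  ; irrefl = λ { (a≢a , _) → a≢a refl }
  }
  where
  u≢v : u ≢ v
  u≢v refl = irrefl G e
  CAdj : Fin n → Fin n → Set
  CAdj a b = a ≢ b × Σ (Fin (suc n)) λ x → Σ (Fin (suc n)) λ y →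
               merge u v u≢v x ≡ a × merge u v u≢v y ≡ b × Adj G x y

data _≼_ : ∀ {m n} → Graph m → Graph n → Set₁ where
  done : ∀ {m n} {H : Graph m} {G : Graph n} → G ≅ H → H ≼ G
  step : ∀ {m n} {H : Graph m} {G : Graph (suc n)} (u v : Fin (suc n))
         (e : Adj G u v) → H ≼ contract G u v e → H ≼ G

record Classified : Set₁ where
  field
    C     : Set
    adjC  : C → C → Bool
    symC  : ∀ a b → T (adjC a b) → T (adjC b a)
    irrC  : ∀ a → ¬ T (adjC a a)

classGraph : ∀ {n} (K : Classified) → (Fin n → Classified.C K) → Graph n
classGraph K cls = record
  { Adj    = λ x y → T (adjC (cls x) (cls y))
  ; symAdj = λ {x} {y} → symC (cls x) (cls y)
  ; irrefl = λ {x} → irrC (cls x)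
  }
  where open Classified K

data BipC : Set where sideA sideB : BipC

bipAdj : BipC → BipC → Bool
bipAdj sideA sideB = true
bipAdj sideB sideA = true
bipAdj _     _     = false

BipK : Classified
BipK = record
  { C = BipC ; adjC = bipAdj
  ; symC = λ { sideA sideB t → t ; sideB sideA t → t ; sideA sideA () ; sideB sideB () }
  ; irrC = λ { sideA () ; sideB () }
  }

K2 : (r : ℕ) → Graph (2 + r)
K2 r = classGraph BipK (λ x → if toℕ x <ᵇ 2 then sideA else sideB)

-- W_{p,q} on Fin (2 + (2 + q) + p):
--   0,1            : the two new (non-adjacent) apex vertices
--   2,3            : the side of size 2 of K_{2,q}
--   4 .. 3+q       : the side of size q of K_{2,q}
--   4+q .. 3+q+p   : the p vertices of the edgeless graph \overline{K}_p
data WC : Set where apex small big isol : WC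

wAdj : WC → WC → Bool
wAdj apex  small = true
wAdj apex  big   = true
wAdj apex  isol  = true
wAdj small apex  = true
wAdj big   apex  = true
wAdj isol  apex  = true
wAdj small big   = true
wAdj big   small = true
wAdj _     _     = false

WK : Classified
WK = record
  { C = WC ; adjC = wAdj
  ; symC = λ { apex small t → t ; apex big t → t ; apex isol t → t
             ; small apex t → t ; big apex t → t ; isol apex t → t
             ; small big t → t ; big small t → t
             ; apex apex () ; small small () ; small isol ()
             ; big big () ; big isol () ; isol small () ; isol big () ; isol isol () }
  ; irrC = λ { apex () ; small () ; big () ; isol () }
  }

wClass : (q : ℕ) → ℕ → WC
wClass q k = if k <ᵇ 2 then apex else
             if k <ᵇ 4 then small else
             if k <ᵇ (4 + q) then big else isol

W : (p q : ℕ) → Graph (2 + (2 + q) + p)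
W p q = classGraph WK (λ x → wClass q (toℕ x))

-- Contracting G onto H amounts to giving a surjection ψ : V(G) → V(H) with connected
-- fibres (the branch sets) such that every edge of G lies inside a fibre or joins
-- adjacent vertices of H, and every edge of H is the image of an edge of G.
-- Let ψ contract W_{p,q} onto K_{2,r} with r ≥ 3.  An apex is adjacent to all vertices
-- but the other apex, so if it were sent to the r-side, that side would be covered
-- by the images of the two apexes; hence both apexes go to the 2-side, into distinct
-- branch sets, and every other vertex, adjacent to both, goes to the r-side.  As
-- adjacent vertices on the same side are merged, the branch sets of ψ are those of
-- the obvious contraction: the apexes, the K_{2,q} and the p isolated vertices.
-- So r + 2 = p + 3.
module Submission where

open import Defs
open import Data.Bool using (true; false; T; if_then_else_)
open import Data.Unit using (tt)
open import Data.Nat using (ℕ; suc; _≤_; _+_; _<ᵇ_; s≤s)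
open import Data.Nat.Properties using (+-comm; +-cancelˡ-≡; <ᵇ⇒<; <⇒<ᵇ; m+n≮m)
open import Data.Fin using (Fin; zero; suc; toℕ; #_; punchIn; splitAt; _↑ˡ_; _↑ʳ_)
open import Data.Fin.Properties
  using ( _≟_; any?; suc-injective; 0≢1+n; cantor-schröder-bernstein
        ; punchIn-punchOut; punchOut-punchIn; punchOut-cong; punchInᵢ≢i
        ; toℕ<n; toℕ-↑ˡ; toℕ-↑ʳ; splitAt-↑ˡ; splitAt-↑ʳ; splitAt⁻¹-↑ˡ; splitAt⁻¹-↑ʳ )
open import Data.Product using (∃; ∃₂; _×_; _,_; proj₁; proj₂; map₂)
open import Data.Sum using (_⊎_; inj₁; inj₂; [_,_]′)
open import Data.Empty using (⊥-elim)
open import Function using (_∘_; id; const)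
open import Function.Bundles using (Inverse; mk↔ₛ′; _⇔_; mk⇔)
open import Function.Definitions using (Injective)
open import Relation.Binary.Construct.Closure.ReflexiveTransitive as Star using (Star; ε; _◅_; _◅◅_)
open import Relation.Nullary using (¬_; yes; no)
open import Relation.Nullary.Decidable using (_×-dec_; ¬?)
open import Relation.Binary.PropositionalEquality using (_≡_; _≢_; refl; sym; trans; cong; subst; subst₂)

private
  variable
    l m n r s : ℕ

Contracted : (G : Graph n) → (Fin n → Fin m) → Fin n → Fin n → Set
Contracted G ψ x y = Adj G x y × ψ x ≡ ψ y

record IsContraction (G : Graph n) (H : Graph m) (ψ : Fin n → Fin m) : Set where
  field
    surjective      : ∀ h → ∃ λ x → ψ x ≡ h
    edge-image      : ∀ {x y} → Adj G x y → ψ x ≡ ψ y ⊎ Adj H (ψ x) (ψ y)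
    edge-lift       : ∀ {a b} → Adj H a b → ∃₂ λ x y → ψ x ≡ a × ψ y ≡ b × Adj G x y
    fibre-connected : ∀ {x y} → ψ x ≡ ψ y → Star (Contracted G ψ) x y

∘-isContraction : ∀ {G : Graph n} {H : Graph m} {K : Graph l} {ψ φ} →
                  IsContraction G H ψ → IsContraction H K φ → IsContraction G K (φ ∘ ψ)
∘-isContraction {G = G} {H} {K} {ψ} {φ} cψ cφ = record
  { surjective      = surjective
  ; edge-image      = edge-image
  ; edge-lift       = edge-lift
  ; fibre-connected = λ e → lift-walk (φ.fibre-connected e) refl refl
  }
  where
  module ψ = IsContraction cψ
  module φ = IsContraction cφ

  surjective : ∀ c → ∃ λ x → φ (ψ x) ≡ c
  surjective c with φ.surjective c
  ... | a , refl with ψ.surjective a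
  ...   | x , refl = x , refl

  edge-image : ∀ {x y} → Adj G x y → φ (ψ x) ≡ φ (ψ y) ⊎ Adj K (φ (ψ x)) (φ (ψ y))
  edge-image g with ψ.edge-image g
  ... | inj₁ e = inj₁ (cong φ e)
  ... | inj₂ h = φ.edge-image h

  edge-lift : ∀ {a b} → Adj K a b → ∃₂ λ x y → φ (ψ x) ≡ a × φ (ψ y) ≡ b × Adj G x y
  edge-lift c with φ.edge-lift c
  ... | _ , _ , refl , refl , h with ψ.edge-lift h
  ...   | x , y , refl , refl , g = x , y , refl , refl , g

  within-fibre : ∀ {x y} → ψ x ≡ ψ y → Star (Contracted G (φ ∘ ψ)) x y
  within-fibre e = Star.map (map₂ (cong φ)) (ψ.fibre-connected e)

  lift-walk : ∀ {a b x y} → Star (Contracted H φ) a b → ψ x ≡ a → ψ y ≡ b →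
              Star (Contracted G (φ ∘ ψ)) x y
  lift-walk ε               ex ey = within-fibre (trans ex (sym ey))
  lift-walk ((h , e) ◅ hs) ex ey with ψ.edge-lift h
  ... | _ , _ , refl , refl , g = within-fibre ex ◅◅ (g , e) ◅ lift-walk hs refl ey

≅⇒isContraction : ∀ {G : Graph n} {H : Graph m} (iso : G ≅ H) →
                  IsContraction G H (Inverse.to (_≅_.bij iso))
≅⇒isContraction {G = G} {H} iso = record
  { surjective      = λ h → from h , strictlyInverseˡ h
  ; edge-image      = λ {x} {y} g → inj₂ (preserve x y g)
  ; edge-lift       = λ {a} {b} h → from a , from b , strictlyInverseˡ a , strictlyInverseˡ b ,
                        reflect (from a) (from b)
                          (subst₂ (Adj H) (sym (strictlyInverseˡ a)) (sym (strictlyInverseˡ b)) h)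
  ; fibre-connected = λ e → subst (Star _ _) (to-injective e) ε
  }
  where
  open _≅_ iso
  open Inverse bij
  to-injective : ∀ {x y} → to x ≡ to y → x ≡ y
  to-injective {x} {y} e = trans (sym (strictlyInverseʳ x)) (trans (cong from e) (strictlyInverseʳ y))

module _ {n : ℕ} {u v : Fin (suc n)} (u≢v : u ≢ v) where

  private
    merge′ : Fin (suc n) → Fin n
    merge′ = merge u v u≢v

  -- contract merges along its own proof of u ≢ v, which is out of scope here.
  merge-irrelevant : ∀ (u≢v′ : u ≢ v) x → merge u v u≢v′ x ≡ merge′ x
  merge-irrelevant _ x with v ≟ x
  ... | yes _ = punchOut-cong v refl
  ... | no  _ = refl

  merge-punchIn : ∀ a → merge′ (punchIn v a) ≡ a
  merge-punchIn a with v ≟ punchIn v a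
  ... | yes v≡ = ⊥-elim (punchInᵢ≢i v a (sym v≡))
  ... | no  _  = trans (punchOut-cong v refl) (punchOut-punchIn v)

  punchIn-merge : ∀ x → punchIn v (merge′ x) ≡ x ⊎ (x ≡ v × punchIn v (merge′ x) ≡ u)
  punchIn-merge x with v ≟ x
  ... | yes refl = inj₂ (refl , punchIn-punchOut _)
  ... | no  v≢x  = inj₁ (punchIn-punchOut v≢x)

  merge-v≡merge-u : merge′ v ≡ merge′ u
  merge-v≡merge-u with v ≟ v | v ≟ u
  ... | no  v≢v | _       = ⊥-elim (v≢v refl)
  ... | yes _   | yes v≡u = ⊥-elim (u≢v (sym v≡u))
  ... | yes _   | no  _   = punchOut-cong v refl

adj⇒≢ : ∀ (G : Graph n) {x y} → Adj G x y → x ≢ y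
adj⇒≢ G g refl = irrefl G g

module _ {n : ℕ} (G : Graph (suc n)) {u v : Fin (suc n)} (e : Adj G u v) where

  private
    u≢v : u ≢ v
    u≢v = adj⇒≢ G e
    merge′ : Fin (suc n) → Fin n
    merge′ = merge u v u≢v

  merge-isContraction : IsContraction G (contract G u v e) merge′
  merge-isContraction = record
    { surjective      = λ a → punchIn v a , merge-punchIn u≢v a
    ; edge-image      = edge-image
    ; edge-lift       = λ { (_ , x , y , refl , refl , g) →
                              x , y , merge-irrelevant u≢v _ x , merge-irrelevant u≢v _ y , g }
    ; fibre-connected = λ {x} {y} mx≡my →
                          collapsed-walk (cong (punchIn v) mx≡my) (punchIn-merge u≢v x) (punchIn-merge u≢v y)
    }
    where
    edge-image : ∀ {x y} → Adj G x y → merge′ x ≡ merge′ y ⊎ Adj (contract G u v e) (merge′ x) (merge′ y)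
    edge-image {x} {y} g with merge′ x ≟ merge′ y
    ... | yes mx≡my = inj₁ mx≡my
    ... | no  mx≢my = inj₂ (mx≢my , x , y , merge-irrelevant u≢v _ x , merge-irrelevant u≢v _ y , g)

    collapsed-walk : ∀ {x y} {a b : Fin (suc n)} → a ≡ b →
                     a ≡ x ⊎ (x ≡ v × a ≡ u) → b ≡ y ⊎ (y ≡ v × b ≡ u) →
                     Star (Contracted G merge′) x y
    collapsed-walk refl (inj₁ refl)          (inj₁ refl)          = ε
    collapsed-walk refl (inj₁ refl)          (inj₂ (refl , refl)) = (e , sym (merge-v≡merge-u u≢v)) ◅ ε
    collapsed-walk refl (inj₂ (refl , refl)) (inj₁ refl)          = (symAdj G e , merge-v≡merge-u u≢v) ◅ ε
    collapsed-walk refl (inj₂ (refl , refl)) (inj₂ (refl , refl)) = ε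

≼⇒isContraction : ∀ {H : Graph m} {G : Graph n} → H ≼ G → ∃ (IsContraction G H)
≼⇒isContraction (done G≅H)             = _ , ≅⇒isContraction G≅H
≼⇒isContraction {G = G} (step _ _ e H≼G/e) with ≼⇒isContraction H≼G/e
... | _ , c = _ , ∘-isContraction (merge-isContraction G e) c

injective⇒≅ : ∀ {G : Graph n} {H : Graph m} {ψ} → IsContraction G H ψ →
              (∀ {x y} → ψ x ≡ ψ y → x ≡ y) → G ≅ H
injective⇒≅ {G = G} {H} {ψ} c injective = record
  { bij      = mk↔ₛ′ ψ (proj₁ ∘ surjective) (proj₂ ∘ surjective) (λ x → injective (proj₂ (surjective (ψ x))))
  ; preserve = preserve
  ; reflect  = reflect
  }
  where
  open IsContraction c
  preserve : ∀ x y → Adj G x y → Adj H (ψ x) (ψ y)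
  preserve x y g with edge-image g
  ... | inj₁ ψx≡ψy = ⊥-elim (adj⇒≢ G g (injective ψx≡ψy))
  ... | inj₂ h     = h

  reflect : ∀ x y → Adj H (ψ x) (ψ y) → Adj G x y
  reflect x y h with edge-lift h
  ... | _ , _ , ex , ey , g with injective ex | injective ey
  ...   | refl | refl = g

module _ {n : ℕ} {G : Graph (suc n)} {H : Graph m} {ψ} (c : IsContraction G H ψ)
         {u v : Fin (suc n)} (e : Adj G u v) (ψu≡ψv : ψ u ≡ ψ v) where

  open IsContraction c

  private
    u≢v : u ≢ v
    u≢v = adj⇒≢ G e
    merge′ : Fin (suc n) → Fin n
    merge′ = merge u v u≢v

  ψ-punchIn-merge : ∀ (u≢v′ : u ≢ v) x → ψ (punchIn v (merge u v u≢v′ x)) ≡ ψ x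
  ψ-punchIn-merge u≢v′ x with punchIn-merge u≢v′ x
  ... | inj₁ eq         = cong ψ eq
  ... | inj₂ (refl , eq) = trans (cong ψ eq) ψu≡ψv

  merged-isContraction : IsContraction (contract G u v e) H (ψ ∘ punchIn v)
  merged-isContraction = record
    { surjective      = λ h → let x , ψx≡h = surjective h in merge′ x , trans (ψ-punchIn-merge u≢v x) ψx≡h
    ; edge-image      = λ { (_ , x , y , refl , refl , g) →
                              subst₂ (λ a b → a ≡ b ⊎ Adj H a b)
                                     (sym (ψ-punchIn-merge _ x)) (sym (ψ-punchIn-merge _ y))
                                     (edge-image g) }
    ; edge-lift       = edge-lift′
    ; fibre-connected = λ {a} {b} ψa≡ψb →
                          subst₂ (Star _) (merge-punchIn u≢v a) (merge-punchIn u≢v b)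
                                 (Star.kleisliStar merge′ edge-walk (fibre-connected ψa≡ψb))
    }
    where
    edge-lift′ : ∀ {a b} → Adj H a b →
                 ∃₂ λ x y → ψ (punchIn v x) ≡ a × ψ (punchIn v y) ≡ b × Adj (contract G u v e) x y
    edge-lift′ h with edge-lift h
    ... | x , y , refl , refl , g =
      merge′ x , merge′ y , ψ-punchIn-merge u≢v x , ψ-punchIn-merge u≢v y ,
      (merged-apart , x , y , merge-irrelevant u≢v _ x , merge-irrelevant u≢v _ y , g)
      where
      merged-apart : merge′ x ≢ merge′ y
      merged-apart eq = adj⇒≢ H h (trans (sym (ψ-punchIn-merge u≢v x))
                                   (trans (cong (ψ ∘ punchIn v) eq) (ψ-punchIn-merge u≢v y)))

    edge-walk : ∀ {s t} → Contracted G ψ s t →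
                Star (Contracted (contract G u v e) (ψ ∘ punchIn v)) (merge′ s) (merge′ t)
    edge-walk {s} {t} (g , ψs≡ψt) with merge′ s ≟ merge′ t
    ... | yes eq = subst (Star _ _) eq ε
    ... | no  ne = ((ne , s , t , merge-irrelevant u≢v _ s , merge-irrelevant u≢v _ t , g) ,
                    trans (ψ-punchIn-merge u≢v s) (trans ψs≡ψt (sym (ψ-punchIn-merge u≢v t)))) ◅ ε

isContraction⇒≼ : ∀ {G : Graph n} {H : Graph m} {ψ} → IsContraction G H ψ → H ≼ G
isContraction⇒≼ {G = G} {ψ = ψ} c with any? (λ x → any? (λ y → ¬? (x ≟ y) ×-dec (ψ x ≟ ψ y)))
... | no no-merged-pair = done (injective⇒≅ c injective)
  where
  injective : ∀ {x y} → ψ x ≡ ψ y → x ≡ y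
  injective {x} {y} ψx≡ψy with x ≟ y
  ... | yes x≡y = x≡y
  ... | no  x≢y = ⊥-elim (no-merged-pair (x , y , x≢y , ψx≡ψy))
isContraction⇒≼ {n = suc _} {G = G} {H} {ψ} c | yes (x , y , x≢y , ψx≡ψy) =
  first-edge (IsContraction.fibre-connected c ψx≡ψy) x≢y
  where
  first-edge : ∀ {y} → Star (Contracted G ψ) x y → x ≢ y → H ≼ G
  first-edge ε                    x≢x = ⊥-elim (x≢x refl)
  first-edge ((g , ψx≡ψx′) ◅ _) _   = step x _ g (isContraction⇒≼ (merged-isContraction c g ψx≡ψx′))

pigeonhole₃₂ : ∀ {A : Set} {s t a b c : A} → a ≡ s ⊎ a ≡ t → b ≡ s ⊎ b ≡ t → c ≡ s ⊎ c ≡ t →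
               a ≡ b ⊎ a ≡ c ⊎ b ≡ c
pigeonhole₃₂ (inj₁ refl) (inj₁ refl) _           = inj₁ refl
pigeonhole₃₂ (inj₂ refl) (inj₂ refl) _           = inj₁ refl
pigeonhole₃₂ (inj₁ refl) (inj₂ refl) (inj₁ refl) = inj₂ (inj₁ refl)
pigeonhole₃₂ (inj₁ refl) (inj₂ refl) (inj₂ refl) = inj₂ (inj₂ refl)
pigeonhole₃₂ (inj₂ refl) (inj₁ refl) (inj₁ refl) = inj₂ (inj₂ refl)
pigeonhole₃₂ (inj₂ refl) (inj₁ refl) (inj₂ refl) = inj₂ (inj₁ refl)

same-fibres⇒≡ : ∀ {f : Fin n → Fin r} {g : Fin n → Fin s} →
                (∀ i → ∃ λ x → f x ≡ i) → (∀ j → ∃ λ x → g x ≡ j) →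
                (∀ {x y} → f x ≡ f y → g x ≡ g y) → (∀ {x y} → g x ≡ g y → f x ≡ f y) → r ≡ s
same-fibres⇒≡ f-onto g-onto f⊆g g⊆f =
  cantor-schröder-bernstein (section-injective f-onto g⊆f) (section-injective g-onto f⊆g)
  where
  section-injective : ∀ {k l} {f : Fin n → Fin k} {g : Fin n → Fin l} (f-onto : ∀ i → ∃ λ x → f x ≡ i) →
                      (∀ {x y} → g x ≡ g y → f x ≡ f y) → Injective _≡_ _≡_ (g ∘ proj₁ ∘ f-onto)
  section-injective f-onto g⊆f {i} {j} eq =
    trans (sym (proj₂ (f-onto i))) (trans (g⊆f eq) (proj₂ (f-onto j)))

-- The classifier of K2, so Adj (K2 r) a b computes to T (bipAdj (side a) (side b));
-- on the vertices of W p q, side marks the two apexes.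
side : Fin n → BipC
side x = if toℕ x <ᵇ 2 then sideA else sideB

same-side⇒¬adjacent : ∀ {a b : Fin (2 + r)} → side a ≡ side b → ¬ Adj (K2 r) a b
same-side⇒¬adjacent {a = a} eq = subst (λ c → ¬ T (bipAdj (side a) c)) eq (Classified.irrC BipK (side a))

AdjacentToAllBut : (G : Graph n) → Fin n → Fin n → Set
AdjacentToAllBut G a a′ = ∀ x → x ≢ a → x ≢ a′ → Adj G a x

module _ {G : Graph n} {ψ : Fin n → Fin (2 + r)} (c : IsContraction G (K2 r) ψ) where

  open IsContraction c

  same-side⇒merged : ∀ {x y} → Adj G x y → side (ψ x) ≡ side (ψ y) → ψ x ≡ ψ y
  same-side⇒merged {x} {y} g eq with edge-image g
  ... | inj₁ ψx≡ψy = ψx≡ψy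
  ... | inj₂ h     = ⊥-elim (same-side⇒¬adjacent {a = ψ x} {ψ y} eq h)

  same-side-as-dominating : ∀ {a a′} → AdjacentToAllBut G a a′ →
                            ∀ h → side h ≡ side (ψ a) → h ≡ ψ a ⊎ h ≡ ψ a′
  same-side-as-dominating {a} {a′} dom h side-h with surjective h
  ... | x , refl with x ≟ a | x ≟ a′
  ...   | yes refl | _        = inj₁ refl
  ...   | no  _    | yes refl = inj₂ refl
  ...   | no  x≢a  | no  x≢a′ = inj₁ (sym (same-side⇒merged (dom x x≢a x≢a′) (sym side-h)))

  dominating⇒apart : ∀ {a a′} → AdjacentToAllBut G a a′ → side (ψ a) ≡ sideA → ψ a ≢ ψ a′
  dominating⇒apart {a} {a′} dom side-a ψa≡ψa′ = 0≢1+n (trans (is-ψa (# 0) refl) (sym (is-ψa (# 1) refl)))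
    where
    is-ψa : ∀ h → side h ≡ sideA → h ≡ ψ a
    is-ψa h side-h = [ id , (λ h≡ψa′ → trans h≡ψa′ (sym ψa≡ψa′)) ]′
                       (same-side-as-dominating dom h (trans side-h (sym side-a)))

dominating⇒sideA : ∀ {G : Graph n} {ψ : Fin n → Fin (2 + (3 + r))} → IsContraction G (K2 (3 + r)) ψ →
                   ∀ {a a′} → AdjacentToAllBut G a a′ → side (ψ a) ≡ sideA
dominating⇒sideA {ψ = ψ} c {a} {a′} dom with side (ψ a) in side-a
... | sideA = refl
... | sideB = ⊥-elim (distinct (pigeonhole₃₂ (on-side-B (# 2) refl) (on-side-B (# 3) refl) (on-side-B (# 4) refl)))
  where
  on-side-B : ∀ h → side h ≡ sideB → h ≡ ψ a ⊎ h ≡ ψ a′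
  on-side-B h side-h = same-side-as-dominating c dom h (trans side-h (sym side-a))
  distinct : ¬ (# 2 ≡ # 3 ⊎ # 2 ≡ # 4 ⊎ # 3 ≡ # 4)
  distinct (inj₁ ())
  distinct (inj₂ (inj₁ ()))
  distinct (inj₂ (inj₂ ()))

module _ {G : Graph n} {ψ : Fin n → Fin (2 + r)} {φ : Fin n → Fin (2 + s)}
         (cψ : IsContraction G (K2 r) ψ) (cφ : IsContraction G (K2 s) φ)
         (same-sides : ∀ x → side (ψ x) ≡ side (φ x)) where

  same-sides⇒fibres⊆ : ∀ {x y} → ψ x ≡ ψ y → φ x ≡ φ y
  same-sides⇒fibres⊆ ψx≡ψy =
    Star.fold (λ x y → φ x ≡ φ y) merged refl (IsContraction.fibre-connected cψ ψx≡ψy)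
    where
    merged : ∀ {x y z} → Contracted G ψ x y → φ y ≡ φ z → φ x ≡ φ z
    merged {x} {y} (g , ψx≡ψy) = trans (same-side⇒merged cφ g (trans (sym (same-sides x))
                                          (trans (cong side ψx≡ψy) (same-sides y))))

same-sides⇒≡ : ∀ {G : Graph n} {ψ : Fin n → Fin (2 + r)} {φ : Fin n → Fin (2 + s)} →
               IsContraction G (K2 r) ψ → IsContraction G (K2 s) φ →
               (∀ x → side (ψ x) ≡ side (φ x)) → r ≡ s
same-sides⇒≡ cψ cφ same-sides = +-cancelˡ-≡ 2 _ _
  (same-fibres⇒≡ (IsContraction.surjective cψ) (IsContraction.surjective cφ)
                 (same-sides⇒fibres⊆ cψ cφ same-sides) (same-sides⇒fibres⊆ cφ cψ (sym ∘ same-sides)))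

wClass-nonapex : ∀ q k → wClass q (2 + k) ≢ apex
wClass-nonapex q k with k <ᵇ 2 | k <ᵇ 2 + q
... | true  | _     = λ ()
... | false | true  = λ ()
... | false | false = λ ()

wAdj-apex : ∀ c → c ≢ apex → T (wAdj apex c)
wAdj-apex apex  c≢apex = c≢apex refl
wAdj-apex small _      = tt
wAdj-apex big   _      = tt
wAdj-apex isol  _      = tt

wAdj-isol : ∀ c → T (wAdj isol c) → c ≡ apex
wAdj-isol apex _ = refl

module _ (p q : ℕ) where

  apex-adjacent : ∀ x → Adj (W p q) zero (suc (suc x))
  apex-adjacent x = wAdj-apex _ (wClass-nonapex q (toℕ x))

  apex₀-dominates : AdjacentToAllBut (W p q) zero (suc zero)
  apex₀-dominates zero          x≢0 _   = ⊥-elim (x≢0 refl)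
  apex₀-dominates (suc zero)    _   x≢1 = ⊥-elim (x≢1 refl)
  apex₀-dominates (suc (suc x)) _   _   = apex-adjacent x

  apex₁-dominates : AdjacentToAllBut (W p q) (suc zero) zero
  apex₁-dominates zero          _   x≢0 = ⊥-elim (x≢0 refl)
  apex₁-dominates (suc zero)    x≢1 _   = ⊥-elim (x≢1 refl)
  apex₁-dominates (suc (suc x)) _   _   = apex-adjacent x

  W-contraction-sides : ∀ {r ψ} → IsContraction (W p q) (K2 (3 + r)) ψ → ∀ x → side (ψ x) ≡ side x
  W-contraction-sides c zero       = dominating⇒sideA c apex₀-dominates
  W-contraction-sides c (suc zero) = dominating⇒sideA c apex₁-dominates
  W-contraction-sides {ψ = ψ} c (suc (suc x)) with side (ψ (suc (suc x))) in side-x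
  ... | sideB = refl
  ... | sideA = ⊥-elim (dominating⇒apart c apex₀-dominates side-apex₀ (trans apex₀≡x (sym apex₁≡x)))
    where
    side-apex₀ : side (ψ zero) ≡ sideA
    side-apex₀ = dominating⇒sideA c apex₀-dominates
    apex₀≡x : ψ zero ≡ ψ (suc (suc x))
    apex₀≡x = same-side⇒merged c (apex-adjacent x) (trans side-apex₀ (sym side-x))
    apex₁≡x : ψ (suc zero) ≡ ψ (suc (suc x))
    apex₁≡x = same-side⇒merged c (apex-adjacent x) (trans (dominating⇒sideA c apex₁-dominates) (sym side-x))

-- The branch sets of W p (suc q) as a contraction onto K2 (suc p): the two apexes,
-- the K_{2,1+q} (sent to vertex 2) and each isolated vertex j (sent to 3 + j).
module Collapse (p q : ℕ) where

  private
    k : ℕ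
    k = 2 + suc q

    Wpq : Graph (2 + k + p)
    Wpq = W p (suc q)

  data Inner : Fin (k + p) → Set where
    core     : (i : Fin k) → Inner (i ↑ˡ p)
    isolated : (j : Fin p) → Inner (k ↑ʳ j)

  inner : ∀ x → Inner x
  inner x with splitAt k x in eq
  ... | inj₁ i = subst Inner (splitAt⁻¹-↑ˡ eq) (core i)
  ... | inj₂ j = subst Inner (splitAt⁻¹-↑ʳ eq) (isolated j)

  block : Fin (k + p) → Fin (suc p)
  block x = [ const zero , suc ]′ (splitAt k x)

  block-core : ∀ i → block (i ↑ˡ p) ≡ zero
  block-core i rewrite splitAt-↑ˡ k i p = refl

  block-isolated : ∀ j → block (k ↑ʳ j) ≡ suc j
  block-isolated j rewrite splitAt-↑ʳ k p j = refl

  collapse : Fin (2 + k + p) → Fin (2 + suc p)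
  collapse zero          = zero
  collapse (suc zero)    = suc zero
  collapse (suc (suc x)) = suc (suc (block x))

  class : Fin (2 + k + p) → WC
  class x = wClass (suc q) (toℕ x)

  class-big : ∀ i → class (suc (suc (suc (suc i) ↑ˡ p))) ≡ big
  class-big i rewrite toℕ-↑ˡ i p with toℕ i <ᵇ suc q | <⇒<ᵇ (toℕ<n i)
  ... | true | _ = refl

  class-isolated : ∀ j → class (suc (suc (k ↑ʳ j))) ≡ isol
  class-isolated j rewrite toℕ-↑ʳ q j with q + toℕ j <ᵇ q in lt
  ... | false = refl
  ... | true  = ⊥-elim (m+n≮m q (toℕ j) (<ᵇ⇒< _ _ (subst T (sym lt) tt)))

  isolated-nonapex-nonadjacent : ∀ j y → ¬ Adj Wpq (suc (suc (k ↑ʳ j))) (suc (suc y))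
  isolated-nonapex-nonadjacent j y g =
    wClass-nonapex (suc q) (toℕ y) (wAdj-isol _ (subst (λ c → T (wAdj c (class (suc (suc y))))) (class-isolated j) g))

  nonapex-edge-in-core : ∀ x y → Adj Wpq (suc (suc x)) (suc (suc y)) → block x ≡ block y
  nonapex-edge-in-core x y g with inner x | inner y
  ... | core i     | core j     = trans (block-core i) (sym (block-core j))
  ... | isolated j | _          = ⊥-elim (isolated-nonapex-nonadjacent j y g)
  ... | core _     | isolated j =
    ⊥-elim (isolated-nonapex-nonadjacent j x (symAdj Wpq {suc (suc x)} {suc (suc (k ↑ʳ j))} g))

  inner-section : Fin (suc p) → Fin (k + p)
  inner-section zero    = zero
  inner-section (suc j) = k ↑ʳ j

  section : Fin (2 + suc p) → Fin (2 + k + p)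
  section zero          = zero
  section (suc zero)    = suc zero
  section (suc (suc b)) = suc (suc (inner-section b))

  collapse-section : ∀ h → collapse (section h) ≡ h
  collapse-section zero                = refl
  collapse-section (suc zero)          = refl
  collapse-section (suc (suc zero))    = refl
  collapse-section (suc (suc (suc j))) = cong (λ b → suc (suc b)) (block-isolated j)

  edge-image : ∀ {x y} → Adj Wpq x y → collapse x ≡ collapse y ⊎ Adj (K2 (suc p)) (collapse x) (collapse y)
  edge-image {zero}        {suc (suc _)} _ = inj₂ tt
  edge-image {suc zero}    {suc (suc _)} _ = inj₂ tt
  edge-image {suc (suc _)} {zero}        _ = inj₂ tt
  edge-image {suc (suc _)} {suc zero}    _ = inj₂ tt
  edge-image {suc (suc x)} {suc (suc y)} g = inj₁ (cong (λ b → suc (suc b)) (nonapex-edge-in-core x y g))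

  Lifts : Fin (2 + suc p) → Fin (2 + suc p) → Set
  Lifts a b = ∃₂ λ x y → collapse x ≡ a × collapse y ≡ b × Adj Wpq x y

  lifts-sym : ∀ {a b} → Lifts a b → Lifts b a
  lifts-sym (x , y , cx≡a , cy≡b , g) = y , x , cy≡b , cx≡a , symAdj Wpq {x} {y} g

  apex₀-lifts : ∀ b → Lifts zero (suc (suc b))
  apex₀-lifts b = zero , section (suc (suc b)) , refl , collapse-section (suc (suc b)) ,
                  apex-adjacent p (suc q) (inner-section b)

  apex₁-lifts : ∀ b → Lifts (suc zero) (suc (suc b))
  apex₁-lifts b = suc zero , section (suc (suc b)) , refl , collapse-section (suc (suc b)) ,
                  apex-adjacent p (suc q) (inner-section b)

  edge-lift : ∀ {a b} → Adj (K2 (suc p)) a b → Lifts a b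
  edge-lift {zero}        {suc (suc b)} _ = apex₀-lifts b
  edge-lift {suc zero}    {suc (suc b)} _ = apex₁-lifts b
  edge-lift {suc (suc a)} {zero}        _ = lifts-sym (apex₀-lifts a)
  edge-lift {suc (suc a)} {suc zero}    _ = lifts-sym (apex₁-lifts a)

  private
    Fibre-edge : Fin (2 + k + p) → Fin (2 + k + p) → Set
    Fibre-edge = Contracted Wpq collapse

  fibre-edge-sym : ∀ {x y} → Fibre-edge x y → Fibre-edge y x
  fibre-edge-sym {x} {y} (g , cx≡cy) = symAdj Wpq {x} {y} g , sym cx≡cy

  core-edge : ∀ i j → Adj Wpq (suc (suc (i ↑ˡ p))) (suc (suc (j ↑ˡ p))) →
              Fibre-edge (suc (suc (i ↑ˡ p))) (suc (suc (j ↑ˡ p)))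
  core-edge i j g = g , cong (λ b → suc (suc b)) (trans (block-core i) (sym (block-core j)))

  -- The second small vertex 3 reaches the hub 2 through the big vertex 4; here q ≥ 1 is used.
  core-to-hub : ∀ i → Star Fibre-edge (suc (suc (i ↑ˡ p))) (suc (suc zero))
  core-to-hub zero          = ε
  core-to-hub (suc zero)    = core-edge (suc zero) (suc (suc zero)) tt ◅ core-to-hub (suc (suc zero))
  core-to-hub (suc (suc i)) =
    core-edge (suc (suc i)) zero (subst (λ c → T (wAdj c small)) (sym (class-big i)) tt) ◅ ε

  nonapex-fibre-connected : ∀ x y → block x ≡ block y → Star Fibre-edge (suc (suc x)) (suc (suc y))
  nonapex-fibre-connected x y eq with inner x | inner y
  ... | core i     | core j      = core-to-hub i ◅◅ Star.reverse fibre-edge-sym (core-to-hub j)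
  ... | core i     | isolated j  = ⊥-elim (0≢1+n (trans (sym (block-core i)) (trans eq (block-isolated j))))
  ... | isolated j | core i      = ⊥-elim (0≢1+n (trans (sym (block-core i)) (trans (sym eq) (block-isolated j))))
  ... | isolated j | isolated j′ with suc-injective (trans (sym (block-isolated j)) (trans eq (block-isolated j′)))
  ...   | refl = ε

  fibre-connected : ∀ {x y} → collapse x ≡ collapse y → Star Fibre-edge x y
  fibre-connected {zero}        {zero}        _  = ε
  fibre-connected {suc zero}    {suc zero}    _  = ε
  fibre-connected {suc (suc x)} {suc (suc y)} eq = nonapex-fibre-connected x y (suc-injective (suc-injective eq))
  fibre-connected {zero}        {suc zero}    ()
  fibre-connected {zero}        {suc (suc _)} ()
  fibre-connected {suc zero}    {zero}        ()
  fibre-connected {suc zero}    {suc (suc _)} ()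
  fibre-connected {suc (suc _)} {zero}        ()
  fibre-connected {suc (suc _)} {suc zero}    ()

  collapse-isContraction : IsContraction Wpq (K2 (suc p)) collapse
  collapse-isContraction = record
    { surjective      = λ h → section h , collapse-section h
    ; edge-image      = edge-image
    ; edge-lift       = edge-lift
    ; fibre-connected = fibre-connected
    }

  collapse-sides : ∀ x → side (collapse x) ≡ side x
  collapse-sides zero          = refl
  collapse-sides (suc zero)    = refl
  collapse-sides (suc (suc _)) = refl

lemma13 : ∀ (p q r : ℕ) → 3 ≤ p → 3 ≤ q → 3 ≤ r →
            ((K2 r ≼ W p q) ⇔ (r ≡ p + 1))
lemma13 p (suc q) (suc (suc (suc r))) _ (s≤s _) (s≤s (s≤s (s≤s _))) = mk⇔ size-of-contraction contraction-of-size
  where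
  open Collapse p q using (collapse-isContraction; collapse-sides)

  size-of-contraction : K2 (3 + r) ≼ W p (suc q) → 3 + r ≡ p + 1
  size-of-contraction K2≼W with ≼⇒isContraction K2≼W
  ... | _ , c = trans (same-sides⇒≡ c collapse-isContraction
                        (λ x → trans (W-contraction-sides p (suc q) c x) (sym (collapse-sides x))))
                      (+-comm 1 p)

  contraction-of-size : 3 + r ≡ p + 1 → K2 (3 + r) ≼ W p (suc q)
  contraction-of-size 3+r≡p+1 = subst (λ s → K2 s ≼ W p (suc q)) (trans (+-comm 1 p) (sym 3+r≡p+1))
                                      (isContraction⇒≼ collapse-isContraction)
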